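{- Let $N=(G,f)$ be a Boolean network and $(I_1,\ldots,I_k)$ an ordered partition of $V(G)$ into non-empty sets such that for all $i<j$, $G$ has no directed path from a vertex of $I_j$ to a vertex of $I_i$ (for instance, the vertex sets of the strongly connected components of $G$ listed along a linear extension of the order of the condensation). Define $N_1=N[I_1]$, $N_i^{a_1,\ldots,a_{i-1}}=N(I_1,a_1)\cdots(I_{i-1},a_{i-1})[I_i]$ for $1<i<k$, and $N_k^{a_1,\ldots,a_{k-1}}=N(I_1,a_1)\cdots(I_{k-1},a_{k-1})$. Then $\mathcal{A}(N)$ is the set of Cartesian products $a_1\times\cdots\times a_k$ (identifying $\{0,1\}^{V(G)}$ with $\prod_i\{0,1\}^{I_i}$) such that $a_1\in\mathcal{A}(N_1)$ and $a_i\in\mathcal{A}(N_i^{a_1,\ldots,a_{i-1}})$ for $2\le i\le k$. Consequently $\mathcal{A}(N)$ is in bijection with the dependent sum $$\sum_{a_1\in\mathcal{A}(N_1)}\ \sum_{a_2\in\mathcal{A}(N_2^{a_1})}\cdots\sum_{a_{k-1}\in\mathcal{A}(N_{k-1}^{a_1,\ldots,a_{k-2}})}\mathcal{A}(N_k^{a_1,\ldots,a_{k-1}}).$$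
   Context: Let $\mathbb{B}=\{0,1\}$. A Boolean network is a pair $N=(G,f)$ where $G$ is a finite directed graph and $f=(f_v)_{v\in V(G)}$ with $f_v:\mathbb{B}^{G^-(v)}\to\mathbb{B}$, $G^-(v)$ the in-neighbourhood of $v$. $\mathrm{ASTG}(N)$ has vertex set $\mathbb{B}^{V(G)}$ and an edge from $x$ to $y$ iff $x,y$ differ in exactly one coordinate $v$ and $f_v(x\restriction G^-(v))=y_v\neq x_v$; networks on a given vertex set are identified with such partial orientations. Attractors of $N$ are the terminal strongly connected components of $\mathrm{ASTG}(N)$ (as sets of states); $\mathcal{A}(N)$ is the set of attractors. For $J$ closed under in-neighbours, $N[J]=(G[J],(f_v)_{v\in J})$. For $I\subseteq V(G)$ with no edge from $V(G)\setminus I$ to $I$, $x\in\mathbb{B}^I$, $v\notin I$: $f^x_v(y)=f_v(z)$ where $z\in\mathbb{B}^{G^-(v)}$ agrees with $x$ on $G^-(v)\cap I$ and with $y$ on $G^-(v)\setminus I$; $N(I,x)=(G[V(G)\setminus I],(f^x_v)_{v\notin I})$; for $a\subseteq\mathbb{B}^I$, $N(I,a)$ is the network on $V(G)\setminus I$ whose ASTG is the edge union of the $\mathrm{ASTG}(N(I,x))$, $x\in a$. Iterated expressions like $N(I_1,a_1)(I_2,a_2)$ apply these constructions successively (to the network $N(I_1,a_1)$ on $I_2\cup\cdots\cup I_k$ with the set $I_2$, etc.). -}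

module Defs where

open import Data.Nat using (ℕ; zero; suc; _≤_; _<_; _≡ᵇ_)
open import Data.Nat.Properties using (<⇒≤)
open import Data.Fin using (Fin; toℕ; fromℕ<)
open import Data.Fin.Properties using (toℕ<n)
open import Data.Bool using (Bool; true; false; not; _∧_; if_then_else_; T)
open import Data.Product using (Σ; _×_; _,_; proj₁; proj₂)
open import Data.Unit using (tt)
open import Relation.Binary.PropositionalEquality using (_≡_; _≢_)

-- Every (sub)network
-- that arises is a network on a vertex subset S ⊆ Fin n, given as a
-- Boolean predicate S : Fin n → Bool.  A state on S is represented by a
-- total function Fin n → Bool, two such functions representing the same
-- state on S iff they agree on S (relation _≈[_]_ below); values outside
-- S are irrelevant.

Subset : ℕ → Set
Subset n = Fin n → Bool

State : ℕ → Set
State n = Fin n → Bool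

full : ∀ {n} → Subset n
full _ = true

_≈[_]_ : ∀ {n} → State n → Subset n → State n → Set
x ≈[ S ] y = ∀ v → T (S v) → x v ≡ y v

record StateSet (n : ℕ) (S : Subset n) : Set₁ where
  field
    mem : State n → Set
    ext : ∀ x y → x ≈[ S ] y → mem x → mem y
open StateSet public

_≐_ : ∀ {n S} → StateSet n S → StateSet n S → Set
A ≐ B = ∀ x → (mem A x → mem B x) × (mem B x → mem A x)

-- Boolean networks N = (G , f) on Fin n.  f v : 𝔹^{G⁻(v)} → 𝔹 is given as
-- a function of the whole state that only depends on in-neighbours of v.

record BN (n : ℕ) : Set where
  field
    G     : Fin n → Fin n → Bool          -- G u v : there is an arc u → v
    f     : Fin n → State n → Bool
    local : ∀ v x y → (∀ u → T (G u v) → x u ≡ y u) → f v x ≡ f v y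
open BN public

data Path {n : ℕ} (G : Fin n → Fin n → Bool) : Fin n → Fin n → Set where
  arc  : ∀ {u v} → T (G u v) → Path G u v
  _∷_  : ∀ {u w v} → T (G u w) → Path G w v → Path G u v

-- Networks identified with partial orientations of the hypercube:
-- a vertex set vs ⊆ Fin n and, for each state x and vertex v ∈ vs,
-- whether the ASTG has the arc x → x with v flipped ("v flips in x").

record Net (n : ℕ) : Set₁ where
  field
    vs   : Subset n
    flip : State n → Fin n → Set
open Net public

toNet : ∀ {n} → BN n → Net n
toNet N = record { vs = full ; flip = λ x v → f N v x ≡ not (x v) }

Edge : ∀ {n} → Net n → State n → State n → Set
Edge {n} M x y = Σ (Fin n) λ v →
  T (vs M v) × (y v ≡ not (x v)) × (∀ u → T (vs M u) → u ≢ v → y u ≡ x u) × flip M x v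

data Reach {n : ℕ} (M : Net n) : State n → State n → Set where
  here : ∀ {x y} → x ≈[ vs M ] y → Reach M x y
  step : ∀ {x z y} → Edge M x z → Reach M z y → Reach M x y

record IsAttractor {n : ℕ} (M : Net n) (A : StateSet n (vs M)) : Set where
  field
    nonempty  : Σ (State n) λ x → mem A x
    connected : ∀ x y → mem A x → mem A y → Reach M x y
    maximal   : ∀ x y → mem A x → Reach M x y → Reach M y x → mem A y
    terminal  : ∀ x y → mem A x → Edge M x y → mem A y

merge : ∀ {n} → Subset n → State n → State n → State n
merge I x y u = if I u then x u else y u

condState : ∀ {n} → Net n → (I : Subset n) → State n → Net n
condState M I x = record
  { vs   = λ v → vs M v ∧ not (I v)
  ; flip = λ y v → flip M (merge I x y) v }

-- N(I , a): the network on vs ∖ I whose ASTG is the edge union of the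
-- ASTG(N(I , x)), x ∈ a
condSet : ∀ {n} → Net n → (I : Subset n) → StateSet n I → Net n
condSet {n} M I a = record
  { vs   = λ v → vs M v ∧ not (I v)
  ; flip = λ y v → Σ (State n) λ x → mem a x × flip (condState M I x) y v }

-- N[J]: restriction to J (J closed under in-neighbours; the local
-- functions of vertices in J then do not depend on values outside J)
restrict : ∀ {n} → Net n → Subset n → Net n
restrict M J = record { vs = J ; flip = flip M }

-- Ordered partitions (I₁ , … , I_k) of Fin n, given by the block index
-- part v of each vertex v (block i of the paper is I_{i+1}).

block : ∀ {n k} → (Fin n → Fin k) → Fin k → Subset n
block part i v = toℕ (part v) ≡ᵇ toℕ i

Family : ∀ {n k} → (Fin n → Fin k) → Set₁
Family {n} {k} part = (i : Fin k) → StateSet n (block part i)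

iter : ∀ {n k} → BN n → (part : Fin n → Fin k) → Family part → (j : ℕ) → j ≤ k → Net n
iter N part a zero    _ = toNet N
iter N part a (suc j) p =
  condSet (iter N part a j (<⇒≤ p)) (block part (fromℕ< p)) (a (fromℕ< p))

-- N_i^{a₁,…,a_{i-1}} = N(I₁ , a₁) ⋯ (I_{i-1} , a_{i-1}) [I_i]
-- (for the last block the restriction is the identity, so this is also N_k)
subNet : ∀ {n k} → BN n → (part : Fin n → Fin k) → Family part → Fin k → Net n
subNet N part a i = restrict (iter N part a (toℕ i) (<⇒≤ (toℕ<n i))) (block part i)

Admissible : ∀ {n k} → BN n → (part : Fin n → Fin k) → Family part → Set
Admissible N part a = ∀ i → IsAttractor (subNet N part a i) (a i)

prod : ∀ {n k} → (part : Fin n → Fin k) → Family part → StateSet n full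
prod part a = record
  { mem = λ x → ∀ i → mem (a i) x
  ; ext = λ x y x≈y hx i → ext (a i) x y (λ v _ → x≈y v tt) (hx i) }

-- Rank each vertex by the index of its block.  Since no arc goes down in rank, f_v only
-- reads vertices of rank ≤ rank v, so the lower blocks evolve autonomously: any walk in
-- the ASTG of N can be replayed on the vertices of rank ≤ m from any state agreeing on
-- them, without touching the higher ranks.  The conditioned network N_i^{a₁…a_{i-1}} flips
-- v at y exactly when some state of a₁ × ⋯ × a_{i-1} that agrees with y on the blocks
-- i, …, k flips v in N.
--
-- If each a_i is an attractor of N_i, then a₁ × ⋯ × a_k is closed under the moves of N,
-- and two of its states are connected by induction on the number of blocks: a walk in N_i
-- is lifted to N by first moving the lower blocks to a witness of each flip.
-- Conversely, for an attractor A of N let a_i be the projection of A to I_i.  Replaying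
-- walks inside A on the lower blocks shows, block by block, that A reaches every state of
-- a₁ × ⋯ × a_k, so A is that product; projecting walks inside A to I_i shows that a_i is an
-- attractor of N_i.  Finally a product of non-empty sets determines its factors.
module Submission where

open import Defs
open import Data.Nat using (ℕ)
open import Data.Fin using (Fin) renaming (_<_ to _<ᶠ_)
open import Data.Product using (Σ; _×_)
open import Data.Empty using (⊥)
open import Relation.Binary.PropositionalEquality using (_≡_)
open import Function.Bundles using (_⇔_)

import Data.Nat as ℕ
open import Data.Nat using (zero; suc; _≤_; _<_; z≤n; _<ᵇ_)
open import Data.Nat.Properties
  using (≡ᵇ⇒≡; ≡⇒≡ᵇ; <ᵇ⇒<; <⇒<ᵇ; ≤-refl; ≤-reflexive; ≤-trans; <⇒≤; <⇒≢; <⇒≱; ≮⇒≥; ≤∧≢⇒<;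
         ≤-pred; m<n⇒m<1+n; n<1+n; m≤n⇒m<n∨m≡n)
import Data.Fin as Fin
open import Data.Fin using (toℕ; fromℕ<)
open import Data.Fin.Properties using (toℕ-fromℕ<; toℕ-injective; toℕ<n)
open import Data.Bool using (true; false; not; T)
open import Data.Vec.Functional using (updateAt)
open import Data.Vec.Functional.Properties using (updateAt-updates; updateAt-minimal)
open import Data.Product using (_,_; proj₁; proj₂; swap)
open import Data.Sum using ([_,_]; inj₁; inj₂)
open import Data.Empty using (⊥-elim)
open import Data.Unit using (tt)
open import Function using (_∘_; id)
open import Function.Bundles using (mk⇔)
open import Relation.Nullary using (¬_; yes; no)
open import Relation.Binary.PropositionalEquality
  using (refl; sym; trans; cong; subst; module ≡-Reasoning)

_≈⟨_⟩_ : ∀ {n} → State n → (Fin n → Set) → State n → Set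
x ≈⟨ P ⟩ y = ∀ u → P u → x u ≡ y u

merge-in : ∀ {n} (I : Subset n) x y u → T (I u) → merge I x y u ≡ x u
merge-in I _ _ u _ with I u
... | true = refl

merge-out : ∀ {n} (I : Subset n) x y u → ¬ T (I u) → merge I x y u ≡ y u
merge-out I _ _ u u∉I with I u
... | true  = ⊥-elim (u∉I tt)
... | false = refl

merge-≡ˡ : ∀ {n} (I : Subset n) x y u → (¬ T (I u) → x u ≡ y u) → merge I x y u ≡ x u
merge-≡ˡ I _ _ u x≡y with I u
... | true  = refl
... | false = sym (x≡y id)

toggle : ∀ {n} → State n → Fin n → State n
toggle x v = updateAt x v not

toggle-follows-edge : ∀ {n} (M : Net n) {P : Fin n → Set} {s x x'} (e : Edge M x x') →
  (∀ u → P u → T (vs M u)) → s ≈⟨ P ⟩ x → toggle s (proj₁ e) ≈⟨ P ⟩ x'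
toggle-follows-edge _ {s = s} (v , _ , x'v , others , _) P⊆vs s≈x u Pu with u Fin.≟ v
... | yes refl = trans (updateAt-updates v s) (trans (cong not (s≈x v Pu)) (sym x'v))
... | no u≢v   = trans (updateAt-minimal u v s u≢v) (trans (s≈x u Pu) (sym (others u (P⊆vs u Pu) u≢v)))

edge-fixes : ∀ {n} (M : Net n) {P : Fin n → Set} {x x'} (e : Edge M x x') →
  (∀ u → P u → T (vs M u)) → ¬ P (proj₁ e) → x' ≈⟨ P ⟩ x
edge-fixes _ (v , _ , _ , others , _) P⊆vs ¬Pv u Pu = others u (P⊆vs u Pu) λ { refl → ¬Pv Pu }

toggle-edge : ∀ {n} (M : Net n) {x y} v → T (vs M v) → flip M x v → toggle x v ≈[ vs M ] y → Edge M x y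
toggle-edge _ {x} v v∈ fl x⁺≈y =
  v , v∈ , trans (sym (x⁺≈y v v∈)) (updateAt-updates v x) ,
  (λ u u∈ u≢v → trans (sym (x⁺≈y u u∈)) (updateAt-minimal u v x u≢v)) , fl

Reach-closed : ∀ {n} {M : Net n} (A : StateSet n (vs M)) → (∀ x y → mem A x → Edge M x y → mem A y) →
  ∀ {x y} → Reach M x y → mem A x → mem A y
Reach-closed A _        (here x≈y)    x∈ = ext A _ _ x≈y x∈
Reach-closed A terminal (step e rest) x∈ = Reach-closed A terminal rest (terminal _ _ x∈ e)

mkIsAttractor : ∀ {n} {M : Net n} {A : StateSet n (vs M)} →
  Σ (State n) (mem A) →
  (∀ x y → mem A x → mem A y → Reach M x y) →
  (∀ x y → mem A x → Edge M x y → mem A y) →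
  IsAttractor M A
mkIsAttractor {A = A} nonempty connected terminal = record
  { nonempty  = nonempty
  ; connected = connected
  ; maximal   = λ x y x∈ x→y _ → Reach-closed A terminal x→y x∈
  ; terminal  = terminal }

IsAttractor-cong : ∀ {n} {M : Net n} {A B : StateSet n (vs M)} →
  A ≐ B → IsAttractor M A → IsAttractor M B
IsAttractor-cong A≐B att = record
  { nonempty  = let (x , x∈) = nonempty in x , proj₁ (A≐B x) x∈
  ; connected = λ x y x∈ y∈ → connected x y (proj₂ (A≐B x) x∈) (proj₂ (A≐B y) y∈)
  ; maximal   = λ x y x∈ x→y y→x → proj₁ (A≐B y) (maximal x y (proj₂ (A≐B x) x∈) x→y y→x)
  ; terminal  = λ x y x∈ e → proj₁ (A≐B y) (terminal x y (proj₂ (A≐B x) x∈) e) }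
  where open IsAttractor att

upTo-induction : ∀ {k} (P : ℕ → Set) → P 0 → (∀ (i : Fin k) → P (toℕ i) → P (suc (toℕ i))) → P k
upTo-induction {k} P base extend = go k ≤-refl
  where
  go : ∀ j → j ≤ k → P j
  go zero    _   = base
  go (suc j) j<k = subst (P ∘ suc) (toℕ-fromℕ< j<k)
    (extend (fromℕ< j<k) (subst P (sym (toℕ-fromℕ< j<k)) (go j (<⇒≤ j<k))))

module _ {n} (N : BN n) where

  flip-edge : ∀ {x v} → f N v x ≡ not (x v) → Edge (toNet N) x (toggle x v)
  flip-edge {v = v} fl = toggle-edge (toNet N) v tt fl (λ _ _ → refl)

  Reach-respˡ : ∀ {x y z} → x ≈[ full ] y → Reach (toNet N) y z → Reach (toNet N) x z
  Reach-respˡ x≈y (here y≈z) = here (λ u _ → trans (x≈y u tt) (y≈z u tt))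
  Reach-respˡ {x} {y} x≈y (step e@(v , _ , _ , _ , fl) rest) =
    step (toggle-edge (toNet N) v tt x-flips (toggle-follows-edge (toNet N) e (λ _ _ → tt) x≈y)) rest
    where
    x-flips : f N v x ≡ not (x v)
    x-flips = trans (local N v x y (λ u _ → x≈y u tt)) (trans fl (cong not (sym (x≈y v tt))))

  Reach-trans : ∀ {x y z} → Reach (toNet N) x y → Reach (toNet N) y z → Reach (toNet N) x z
  Reach-trans (here x≈y)    y→z = Reach-respˡ x≈y y→z
  Reach-trans (step e rest) y→z = step e (Reach-trans rest y→z)

module Blocks {n k} (part : Fin n → Fin k) where

  rank : Fin n → ℕ
  rank u = toℕ (part u)

  block⇒rank : ∀ {i u} → T (block part i u) → rank u ≡ toℕ i
  block⇒rank {i} {u} = ≡ᵇ⇒≡ (rank u) (toℕ i)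

  rank⇒block : ∀ {i u} → rank u ≡ toℕ i → T (block part i u)
  rank⇒block {i} {u} = ≡⇒≡ᵇ (rank u) (toℕ i)

  block⇒part : ∀ {i u} → T (block part i u) → part u ≡ i
  block⇒part = toℕ-injective ∘ block⇒rank

  block-fromℕ< : ∀ {j} (j<k : j < k) {u} → T (block part (fromℕ< j<k) u) → rank u ≡ j
  block-fromℕ< j<k u∈ = trans (block⇒rank u∈) (toℕ-fromℕ< j<k)

  fromℕ<-block : ∀ {j} (j<k : j < k) {u} → rank u ≡ j → T (block part (fromℕ< j<k) u)
  fromℕ<-block j<k eq = rank⇒block (trans eq (sym (toℕ-fromℕ< j<k)))

  _≈[≤_]_ : State n → ℕ → State n → Set
  x ≈[≤ m ] y = x ≈⟨ (λ u → rank u ≤ m) ⟩ y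

  _≈[≥_]_ : State n → ℕ → State n → Set
  x ≈[≥ m ] y = x ≈⟨ (λ u → m ≤ rank u) ⟩ y

  ≈[≥]-top : ∀ {x y} → x ≈[≥ k ] y
  ≈[≥]-top u k≤ = ⊥-elim (<⇒≱ (toℕ<n (part u)) k≤)

  ≈[≥]-block : ∀ {i x y} → x ≈[≥ toℕ i ] y → x ≈[ block part i ] y
  ≈[≥]-block x≈y u u∈ = x≈y u (≤-reflexive (sym (block⇒rank u∈)))

  ≈[≥]-split : ∀ {i x y} → x ≈[ block part i ] y → x ≈[≥ suc (toℕ i) ] y → x ≈[≥ toℕ i ] y
  ≈[≥]-split {i} x≈y x≈[>]y u h with rank u ℕ.≟ toℕ i
  ... | yes eq = x≈y u (rank⇒block eq)
  ... | no ne  = x≈[>]y u (≤∧≢⇒< h (ne ∘ sym))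

  splice : ℕ → State n → State n → State n
  splice j = merge (λ u → rank u <ᵇ j)

  splice-below : ∀ {j} z y u → rank u < j → splice j z y u ≡ z u
  splice-below {j} z y u lt = merge-in (λ u → rank u <ᵇ j) z y u (<⇒<ᵇ lt)

  splice-above : ∀ {j} z y u → j ≤ rank u → splice j z y u ≡ y u
  splice-above {j} z y u ge = merge-out (λ u → rank u <ᵇ j) z y u (λ lt → <⇒≱ (<ᵇ⇒< (rank u) j lt) ge)

  prod-nonempty : ∀ (a : Family part) →
    (∀ i → Σ (State n) (mem (a i))) → Σ (State n) (mem (prod part a))
  prod-nonempty a w = z , λ i → ext (a i) (proj₁ (w i)) z
      (λ u u∈ → cong (λ j → proj₁ (w j) u) (sym (block⇒part u∈))) (proj₂ (w i))
    where
    z : State n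
    z u = proj₁ (w (part u)) u

  prod-cancel : ∀ (a b : Family part) → (∀ i → Σ (State n) (mem (a i))) →
    (∀ x → mem (prod part a) x → mem (prod part b) x) → ∀ i x → mem (a i) x → mem (b i) x
  prod-cancel a b nonempty a⊆b i x x∈ =
    ext (b i) w x (λ u u∈ → merge-in (block part i) x z u u∈) (a⊆b w w∈ i)
    where
    z = proj₁ (prod-nonempty a nonempty)
    w = merge (block part i) x z
    w∈ : ∀ j → mem (a j) w
    w∈ j with j Fin.≟ i
    ... | yes refl = ext (a i) x w (λ u u∈ → sym (merge-in (block part i) x z u u∈)) x∈
    ... | no j≢i   = ext (a j) z w
      (λ u u∈j → sym (merge-out (block part i) x z u λ u∈i →
                        j≢i (trans (sym (block⇒part u∈j)) (block⇒part u∈i))))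
      (proj₂ (prod-nonempty a nonempty) j)

  module _ (a : Family part) where

    InPrefix : ℕ → State n → Set
    InPrefix j z = ∀ i → toℕ i < j → mem (a i) z

    InPrefix-suc : ∀ {j z} i → toℕ i ≡ j → InPrefix j z → mem (a i) z → InPrefix (suc j) z
    InPrefix-suc {z = z} i refl z∈ z∈i i' i'< with m≤n⇒m<n∨m≡n (≤-pred i'<)
    ... | inj₁ lt = z∈ i' lt
    ... | inj₂ eq = subst (λ i'' → mem (a i'') z) (sym (toℕ-injective eq)) z∈i

    InPrefix-splice : ∀ {j} z y → InPrefix j z → InPrefix j (splice j z y)
    InPrefix-splice z y z∈ i lt =
      ext (a i) _ _ (λ u u∈ → sym (splice-below z y u (subst (_< _) (sym (block⇒rank u∈)) lt)))
        (z∈ i lt)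

    InPrefix-toggle : ∀ {j} x v → j ≤ rank v → InPrefix j x → InPrefix j (toggle x v)
    InPrefix-toggle x v j≤rv x∈ i lt = ext (a i) _ _
      (λ u u∈ → sym (updateAt-minimal u v x λ { refl →
                       <⇒≱ (subst (_< _) (sym (block⇒rank u∈)) lt) j≤rv }))
      (x∈ i lt)

  projection : StateSet n full → Family part
  projection A i = record
    { mem = λ x → Σ (State n) λ y → mem A y × y ≈[ block part i ] x
    ; ext = λ x x' x≈x' (y , y∈ , y≈x) → y , y∈ , λ u u∈ → trans (y≈x u u∈) (x≈x' u u∈) }

module Dynamics {n k} (N : BN n) (part : Fin n → Fin k)
  (upward : ∀ u v → T (G N u v) → toℕ (part u) ≤ toℕ (part v)) where
  open Blocks part
  open ≡-Reasoning

  f-lower : ∀ v {x y} → x ≈[≤ rank v ] y → f N v x ≡ f N v y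
  f-lower v x≈y = local N v _ _ (λ u uv → x≈y u (upward u v uv))

  f-splice : ∀ {j v} z w → rank v ≡ j → z ≈⟨ (λ u → rank u ≡ j) ⟩ w → f N v (splice j z w) ≡ f N v z
  f-splice {v = v} z w refl z≈w = f-lower v λ u ru≤rv →
    [ splice-below z w u
    , (λ eq → trans (splice-above z w u (≤-reflexive (sym eq))) (sym (z≈w u eq))) ] (m≤n⇒m<n∨m≡n ru≤rv)

  Reach-lower : ∀ m {p q} → Reach (toNet N) p q → ∀ p' → p' ≈[≤ m ] p →
    Σ (State n) λ q' → Reach (toNet N) p' q' × q' ≈[≤ m ] q × q' ≈[≥ suc m ] p'
  Reach-lower m (here p≈q) p' p'≈p =
    p' , here (λ _ _ → refl) , (λ u h → trans (p'≈p u h) (p≈q u tt)) , (λ _ _ → refl)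
  Reach-lower m {p} (step e@(v , _ , _ , _ , fl) rest) p' p'≈p with rank v ℕ.≤? m
  ... | yes rv≤m =
    let (q' , p'⁺→q' , q'≈q , q'≈p'⁺) =
          Reach-lower m rest (toggle p' v) (toggle-follows-edge (toNet N) e (λ _ _ → tt) p'≈p)
    in q' , step (flip-edge N p'-flips) p'⁺→q' , q'≈q ,
       λ u h → trans (q'≈p'⁺ u h) (updateAt-minimal u v p' λ { refl → <⇒≱ h rv≤m })
    where
    p'-flips : f N v p' ≡ not (p' v)
    p'-flips = begin
      f N v p'   ≡⟨ f-lower v (λ u h → p'≈p u (≤-trans h rv≤m)) ⟩
      f N v p    ≡⟨ fl ⟩
      not (p v)  ≡⟨ cong not (sym (p'≈p v rv≤m)) ⟩
      not (p' v) ∎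
  ... | no rv≰m =
    Reach-lower m rest p'
      (λ u h → trans (p'≈p u h) (sym (edge-fixes (toNet N) e (λ _ _ → tt) rv≰m u h)))

  module _ (a : Family part) where

    flip-iter⇒ : ∀ j (j≤k : j ≤ k) {y v} → j ≤ rank v → flip (iter N part a j j≤k) y v →
      Σ (State n) λ z → InPrefix a j z × z ≈[≥ j ] y × f N v z ≡ not (y v)
    flip-iter⇒ zero    _   {y} _ fl = y , (λ _ ()) , (λ _ _ → refl) , fl
    flip-iter⇒ (suc j) j<k {y} {v} j<rv (x , x∈ , fl) =
      let (z , z∈ , z≈ , fz) = flip-iter⇒ j (<⇒≤ j<k) (<⇒≤ j<rv) fl
      in z ,
         InPrefix-suc a i (toℕ-fromℕ< j<k) z∈
           (ext (a i) x z (λ u u∈ → sym (trans (z≈ u (≤-reflexive (sym (block-fromℕ< j<k u∈))))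
                                               (merge-in B x y u u∈))) x∈) ,
         (λ u h → trans (z≈ u (<⇒≤ h)) (merge-out B x y u (above h))) ,
         trans fz (cong not (merge-out B x y v (above j<rv)))
      where
      i = fromℕ< j<k
      B = block part i
      above : ∀ {u} → suc j ≤ rank u → ¬ T (B u)
      above h u∈ = <⇒≢ h (sym (block-fromℕ< j<k u∈))

    flip-iter⇐ : ∀ j (j≤k : j ≤ k) {y v} z → j ≤ rank v → InPrefix a j z → z ≈[≥ j ] y →
      f N v z ≡ not (y v) → flip (iter N part a j j≤k) y v
    flip-iter⇐ zero _ {y} {v} z _ _ z≈y fz = trans (local N v y z (λ u _ → sym (z≈y u z≤n))) fz
    flip-iter⇐ (suc j) j<k {y} {v} z j<rv z∈ z≈y fz =
      z , z∈ i (subst (_< suc j) (sym (toℕ-fromℕ< j<k)) (n<1+n j)) ,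
      flip-iter⇐ j (<⇒≤ j<k) z (<⇒≤ j<rv) (λ i' lt → z∈ i' (m<n⇒m<1+n lt)) z≈merge
        (trans fz (cong not (sym (merge-out B z y v λ v∈ → <⇒≢ j<rv (sym (block-fromℕ< j<k v∈))))))
      where
      i = fromℕ< j<k
      B = block part i
      z≈merge : z ≈[≥ j ] merge B z y
      z≈merge u h = sym (merge-≡ˡ B z y u λ u∉ → z≈y u (≤∧≢⇒< h λ eq → u∉ (fromℕ<-block j<k (sym eq))))

    subNet-flip⇐ : ∀ i {y v} z → rank v ≡ toℕ i → InPrefix a (toℕ i) z → z ≈[ block part i ] y →
      f N v z ≡ not (y v) → flip (subNet N part a i) y v
    subNet-flip⇐ i {y} z rv z∈ z≈y fz =
      flip-iter⇐ (toℕ i) _ (splice (toℕ i) z y) (≤-reflexive (sym rv)) (InPrefix-splice a z y z∈)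
        (λ u h → splice-above z y u h) (trans (f-splice z y rv (λ u eq → z≈y u (rank⇒block eq))) fz)

    -- s' is s with the blocks below i taken from a witness of the flip.
    subNet-flip⇒ : ∀ i {y v} → rank v ≡ toℕ i → flip (subNet N part a i) y v →
      ∀ s → s ≈[ block part i ] y →
      Σ (State n) λ s' → InPrefix a (toℕ i) s' × s' ≈[≥ toℕ i ] s × f N v s' ≡ not (s' v)
    subNet-flip⇒ i {y} {v} rv fl s s≈y with flip-iter⇒ (toℕ i) _ (≤-reflexive (sym rv)) fl
    ... | z , z∈ , z≈y , fz = s' , InPrefix-splice a z s z∈ , (λ u h → splice-above z s u h) , s'-flips
      where
      s' = splice (toℕ i) z s
      z≈s : z ≈⟨ (λ u → rank u ≡ toℕ i) ⟩ s
      z≈s u eq = trans (z≈y u (≤-reflexive (sym eq))) (sym (s≈y u (rank⇒block eq)))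
      s'-flips : f N v s' ≡ not (s' v)
      s'-flips = begin
        f N v s'   ≡⟨ f-splice z s rv z≈s ⟩
        f N v z    ≡⟨ fz ⟩
        not (y v)  ≡⟨ cong not (sym (s≈y v (rank⇒block rv))) ⟩
        not (s v)  ≡⟨ cong not (sym (splice-above z s v (≤-reflexive (sym rv)))) ⟩
        not (s' v) ∎

  module _ (a : Family part) (adm : Admissible N part a) where

    prod-terminal : ∀ x y → mem (prod part a) x → Edge (toNet N) x y → mem (prod part a) y
    prod-terminal x y x∈ e@(v , _ , _ , _ , fl) i with rank v ℕ.≟ toℕ i
    ... | yes rv = IsAttractor.terminal (adm i) x y (x∈ i)
      (toggle-edge (subNet N part a i) v (rank⇒block rv)
        (subNet-flip⇐ a i x rv (λ j _ → x∈ j) (λ _ _ → refl) fl)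
        (toggle-follows-edge (toNet N) e (λ _ _ → tt) (λ _ _ → refl)))
    ... | no rv≢ =
      ext (a i) x y (λ u u∈ → sym (edge-fixes (toNet N) e (λ _ _ → tt) (rv≢ ∘ block⇒rank) u u∈)) (x∈ i)

    PrefixConnected : ℕ → Set
    PrefixConnected j = ∀ s t → InPrefix a j s → InPrefix a j t → s ≈[≥ j ] t → Reach (toNet N) s t

    lift-subNet-path : ∀ i → PrefixConnected (toℕ i) → ∀ {p q} → Reach (subNet N part a i) p q →
      ∀ s t → InPrefix a (toℕ i) s → InPrefix a (toℕ i) t →
      s ≈[ block part i ] p → t ≈[ block part i ] q → s ≈[≥ suc (toℕ i) ] t → Reach (toNet N) s t
    lift-subNet-path i conn (here p≈q) s t s∈ t∈ s≈p t≈q s≈t =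
      conn s t s∈ t∈ (≈[≥]-split (λ u u∈ → trans (s≈p u u∈) (trans (p≈q u u∈) (sym (t≈q u u∈)))) s≈t)
    lift-subNet-path i conn (step e@(v , v∈ , _ , _ , fl) rest) s t s∈ t∈ s≈p t≈q s≈t
      with subNet-flip⇒ a i (block⇒rank v∈) fl s s≈p
    ... | s₁ , s₁∈ , s₁≈s , fs₁ =
      Reach-trans N (conn s s₁ s∈ s₁∈ (λ u h → sym (s₁≈s u h)))
        (step (flip-edge N fs₁)
          (lift-subNet-path i conn rest (toggle s₁ v) t
            (InPrefix-toggle a s₁ v (≤-reflexive (sym (block⇒rank v∈))) s₁∈) t∈
            (toggle-follows-edge (subNet N part a i) e (λ _ → id)
              (λ u u∈ → trans (≈[≥]-block s₁≈s u u∈) (s≈p u u∈)))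
            t≈q s₁⁺≈t))
      where
      s₁⁺≈t : toggle s₁ v ≈[≥ suc (toℕ i) ] t
      s₁⁺≈t u h = trans (updateAt-minimal u v s₁ λ { refl → <⇒≢ h (sym (block⇒rank v∈)) })
                        (trans (s₁≈s u (<⇒≤ h)) (s≈t u h))

    prod-connected : ∀ x y → mem (prod part a) x → mem (prod part a) y → Reach (toNet N) x y
    prod-connected x y x∈ y∈ =
      upTo-induction PrefixConnected base extend x y (λ i _ → x∈ i) (λ i _ → y∈ i) ≈[≥]-top
      where
      base : PrefixConnected 0
      base s t _ _ s≈t = here (λ u _ → s≈t u z≤n)
      extend : ∀ i → PrefixConnected (toℕ i) → PrefixConnected (suc (toℕ i))
      extend i conn s t s∈ t∈ =
        lift-subNet-path i conn (IsAttractor.connected (adm i) s t (s∈ i ≤-refl) (t∈ i ≤-refl)) s t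
          (λ j lt → s∈ j (m<n⇒m<1+n lt)) (λ j lt → t∈ j (m<n⇒m<1+n lt)) (λ _ _ → refl) (λ _ _ → refl)

    prod-isAttractor : IsAttractor (toNet N) (prod part a)
    prod-isAttractor =
      mkIsAttractor (prod-nonempty a (IsAttractor.nonempty ∘ adm)) prod-connected prod-terminal

  module _ (A : StateSet n full) (att : IsAttractor (toNet N) A) where
    open IsAttractor att

    A-closed : ∀ {x y} → Reach (toNet N) x y → mem A x → mem A y
    A-closed = Reach-closed A terminal

    ReachesPrefix : ℕ → Set
    ReachesPrefix j = ∀ s t → mem A s → InPrefix (projection A) j t → t ≈[≥ j ] s → Reach (toNet N) s t

    -- Walk inside A from s to a witness y of t's block i, replaying only the blocks up to i.
    reaches-prefix-step : ∀ i → ReachesPrefix (toℕ i) → ReachesPrefix (suc (toℕ i))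
    reaches-prefix-step i reach s t s∈ t∈ t≈s with t∈ i ≤-refl
    ... | y , y∈ , y≈t with Reach-lower (toℕ i) (connected s y s∈ y∈) s (λ _ _ → refl)
    ... | q , s→q , q≈y , q≈s =
      Reach-trans N s→q (reach q t (A-closed s→q s∈) (λ j lt → t∈ j (m<n⇒m<1+n lt)) t≈q)
      where
      t≈q : t ≈[≥ toℕ i ] q
      t≈q = ≈[≥]-split (λ u u∈ → sym (trans (q≈y u (≤-reflexive (block⇒rank u∈))) (y≈t u u∈)))
                       (λ u h → trans (t≈s u h) (sym (q≈s u h)))

    prod-projection⊆ : ∀ x → mem (prod part (projection A)) x → mem A x
    prod-projection⊆ x x∈ =
      A-closed (upTo-induction ReachesPrefix base reaches-prefix-step s x s∈ (λ i _ → x∈ i) ≈[≥]-top) s∈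
      where
      s = proj₁ nonempty
      s∈ = proj₂ nonempty
      base : ReachesPrefix 0
      base _ _ _ _ t≈s = here (λ u _ → sym (t≈s u z≤n))

    attractor≐prod-projection : A ≐ prod part (projection A)
    attractor≐prod-projection x = (λ x∈ _ → x , x∈ , λ _ _ → refl) , prod-projection⊆ x

    projection-terminal : ∀ i x x' → mem (projection A i) x →
      Edge (subNet N part (projection A) i) x x' → mem (projection A i) x'
    projection-terminal i x x' (y , y∈ , y≈x) e@(v , v∈ , _ , _ , fl)
      with subNet-flip⇒ (projection A) i (block⇒rank v∈) fl y y≈x
    ... | s , s∈ , s≈y , fs =
      toggle s v , terminal s _ (prod-projection⊆ s s∈a) (flip-edge N fs) ,
      toggle-follows-edge (subNet N part (projection A) i) e (λ _ → id)
        (λ u u∈ → trans (≈[≥]-block s≈y u u∈) (y≈x u u∈))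
      where
      s∈a : ∀ j → mem (projection A j) s
      s∈a j with toℕ j ℕ.<? toℕ i
      ... | yes lt = s∈ j lt
      ... | no ≮   = y , y∈ , λ u u∈ → sym (s≈y u (subst (toℕ i ≤_) (sym (block⇒rank u∈)) (≮⇒≥ ≮)))

    Reach-block : ∀ i {p q} → Reach (toNet N) p q → mem A p → ∀ {p' q'} →
      p ≈[ block part i ] p' → q ≈[ block part i ] q' → Reach (subNet N part (projection A) i) p' q'
    Reach-block i (here p≈q) _ p≈p' q≈q' =
      here (λ u u∈ → trans (sym (p≈p' u u∈)) (trans (p≈q u tt) (q≈q' u u∈)))
    Reach-block i {p} (step e@(v , _ , _ , _ , fl) rest) p∈ {p'} p≈p' q≈q' with rank v ℕ.≟ toℕ i
    ... | yes rv =
      step (toggle-edge (subNet N part (projection A) i) v v∈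
              (subNet-flip⇐ (projection A) i p rv (λ _ _ → p , p∈ , λ _ _ → refl) p≈p'
                 (trans fl (cong not (p≈p' v v∈))))
              (toggle-follows-edge (toNet N) e (λ _ _ → tt) (λ u u∈ → sym (p≈p' u u∈))))
           (Reach-block i rest (terminal _ _ p∈ e) (λ _ _ → refl) q≈q')
      where v∈ = rank⇒block rv
    ... | no rv≢ =
      Reach-block i rest (terminal _ _ p∈ e)
        (λ u u∈ → trans (edge-fixes (toNet N) e (λ _ _ → tt) (rv≢ ∘ block⇒rank) u u∈) (p≈p' u u∈)) q≈q'

    projection-admissible : Admissible N part (projection A)
    projection-admissible i = mkIsAttractor
      (proj₁ nonempty , proj₁ nonempty , proj₂ nonempty , λ _ _ → refl)
      (λ { x y (x₀ , x₀∈ , x₀≈x) (y₀ , y₀∈ , y₀≈y) →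
             Reach-block i (connected x₀ y₀ x₀∈ y₀∈) x₀∈ x₀≈x y₀≈y })
      (projection-terminal i)

theorem8 : ∀ {n k : ℕ} (N : BN n) (part : Fin n → Fin k)
    → (∀ i → Σ (Fin n) λ v → part v ≡ i)
    → (∀ u v → Path (G N) u v → part v <ᶠ part u → ⊥)
    → (∀ (A : StateSet n full) →
         IsAttractor (toNet N) A
           ⇔ Σ (Family part) λ a → Admissible N part a × (A ≐ prod part a))
      × (∀ (a b : Family part) → Admissible N part a → Admissible N part b
           → prod part a ≐ prod part b → ∀ i → a i ≐ b i)
theorem8 N part _ acyclic =
  (λ A → mk⇔
     (λ att → projection A , projection-admissible A att , attractor≐prod-projection A att)
     (λ { (a , adm , A≐a) → IsAttractor-cong (swap ∘ A≐a) (prod-isAttractor a adm) })) ,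
  λ a b adm-a adm-b a≐b i x →
    prod-cancel a b (IsAttractor.nonempty ∘ adm-a) (λ y → proj₁ (a≐b y)) i x ,
    prod-cancel b a (IsAttractor.nonempty ∘ adm-b) (λ y → proj₂ (a≐b y)) i x
  where
  open Blocks part
  open Dynamics N part (λ u v uv → ≮⇒≥ (acyclic u v (arc uv)))
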